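{- Let $n\in\mathbb N$ and let $B\subseteq[n]$ be of the form $B=10B'=\{10b: b\in B'\}$ for some $3$-AP-free set $B'$. Then the hypergraph $\mathcal H_B(n)$ is induced $K_5^-$-free.
   Context: Let $X=\{x_0,\dots,x_n\}$, $Y=\{y_0,\dots,y_n\}$, $Z=\{z_0,\dots,z_n\}$ be pairwise disjoint. For $b\in[n]$, $\mathcal H_b(n)$ is the $5$-uniform hypergraph on $X\cup Y\cup Z$ with edges $E_{i,b}=\{x_i,x_{i+1},y_{i+b},z_{i+2b},z_{i+2b+1}\}$ for $0\leq i\leq n-2b-1$. For $B\subseteq[n]$, $\mathcal H_B(n)=\bigcup_{b\in B}\mathcal H_b(n)$ (union of edge sets on the vertex set $X\cup Y\cup Z$). A set of integers $B'$ is $3$-AP-free if $b_1,b_2,b_3\in B'$ with $2b_1=b_2+b_3$ implies $b_1=b_2=b_3$. The $2$-skeleton of a hypergraph is the graph on the same vertex set in which two vertices are adjacent iff they lie in a common edge. $K_5^-$ is $K_5$ minus one edge. A hypergraph is induced $K_5^-$-free if the vertex set of every copy of $K_5^-$ in its $2$-skeleton is contained in an edge of the hypergraph. -}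

module Defs where

open import Data.Nat using (ℕ; suc; _+_; _*_; _≤_)
open import Data.Fin using (Fin; zero; suc)
open import Data.Product using (Σ; _×_; ∃)
open import Data.Sum using (_⊎_)
open import Relation.Binary.PropositionalEquality using (_≡_; _≢_)
open import Relation.Nullary using (¬_)
open import Function.Definitions using (Injective)

-- Vertices x_k, y_k, z_k of X ∪ Y ∪ Z (index k; only k ≤ n occur in edges,
-- vertices with larger index would be isolated and play no role).
data Vtx : Set where
  x y z : ℕ → Vtx

_∈E[_,_] : Vtx → ℕ → ℕ → Set
v ∈E[ i , b ] =
  v ≡ x i ⊎ v ≡ x (suc i) ⊎ v ≡ y (i + b) ⊎ v ≡ z (i + 2 * b) ⊎ v ≡ z (i + 2 * b + 1)

IsEdge : (ℕ → Set) → ℕ → ℕ → ℕ → Set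
IsEdge B n i b = B b × (i + 2 * b + 1 ≤ n)

Adj : (ℕ → Set) → ℕ → Vtx → Vtx → Set
Adj B n u v = (u ≢ v) × (Σ ℕ λ i → Σ ℕ λ b → IsEdge B n i b × u ∈E[ i , b ] × v ∈E[ i , b ])

-- f : Fin 5 → Vtx is a copy of K5^- in the 2-skeleton, the missing edge being {f 0, f 1}
-- (no loss of generality, since all labellings are quantified).
IsK5Minus : (ℕ → Set) → ℕ → (Fin 5 → Vtx) → Set
IsK5Minus B n f =
  Injective _≡_ _≡_ f ×
  (∀ j k → j ≢ k → ¬ (j ≡ zero × k ≡ suc zero) → ¬ (j ≡ suc zero × k ≡ zero) → Adj B n (f j) (f k))

InducedK5MinusFree : (ℕ → Set) → ℕ → Set
InducedK5MinusFree B n =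
  ∀ (f : Fin 5 → Vtx) → IsK5Minus B n f →
  Σ ℕ λ i → Σ ℕ λ b → IsEdge B n i b × (∀ j → f j ∈E[ i , b ])

Dilate10 : (ℕ → Set) → ℕ → Set
Dilate10 B' b = Σ ℕ λ b' → B' b' × b ≡ 10 * b'

ThreeAPFree : (ℕ → Set) → Set
ThreeAPFree B' = ∀ b₁ b₂ b₃ → B' b₁ → B' b₂ → B' b₃ → 2 * b₁ ≡ b₂ + b₃ → (b₁ ≡ b₂) × (b₂ ≡ b₃)

SubsetRange : (ℕ → Set) → ℕ → Set
SubsetRange B n = ∀ b → B b → (1 ≤ b) × (b ≤ n)

module Submission where

-- A K5⁻ is the union of two K4's of the 2-skeleton sharing a triangle. Every K4 lies in an edge
-- and every triangle lies in at most one edge, so both K4's lie in the same edge.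
-- Inside E_{i,b} the indices are i, i + b, i + 2b up to offsets 0 or 1, while all slopes are
-- multiples of 10, so offsets can be read off modulo 10. Hence two edges through y_j containing
-- x_a and x_{a'} (or z_k and z_{k'}) with |a − a'| ≤ 1 coincide, and two x's and a z, or an x and
-- two z's, also determine their edge. An xyz-triangle spread over three edges has slopes with
-- b₁ + b₂ = 2b₃, so by 3-AP-freeness it lies in one edge; a K4 through y_j is glued from two
-- triangles through y_j, and a K4 x_a x_{a+1} z_k z_{k+1} lies in the edge containing x_a and
-- z_{k+1}, by the same computation modulo 10.

open import Data.Empty using (⊥; ⊥-elim)
open import Data.Fin.Patterns using (0F; 1F; 2F; 3F; 4F)
open import Data.Fin.Properties using (_≟_)
open import Data.List using (List; []; _∷_; _++_; tabulate)
open import Data.List.Relation.Unary.All using (All; []; _∷_)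
open import Data.List.Relation.Unary.All.Properties using (tabulate⁻; ++⁺; ++⁻)
open import Data.List.Relation.Binary.Permutation.Propositional
  using (_↭_; ↭-refl; ↭-prep; ↭-swap; ↭-sym; ↭-trans)
open import Data.List.Relation.Binary.Permutation.Propositional.Properties
  using (All-resp-↭; shift; ++-comm)
open import Data.Nat using (ℕ; suc; _+_; _*_; _≤_; _<_; _⊓_; z≤n; s≤s; NonZero)
open import Data.Nat.Divisibility using (_∣_; divides; m∣m*n; ∣n⇒∣m*n; ∣m∣n⇒∣m+n)
open import Data.Nat.DivMod using (_%_; [m+kn]%n≡m%n; m<n⇒m%n≡m)
open import Data.Nat.Properties hiding (_≟_)
open import Data.Nat.Tactic.RingSolver using (solve-∀)
open import Algebra.Properties.CommutativeSemigroup +-commutativeSemigroup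
  using (interchange)
open import Data.Product using (Σ; _×_; _,_; proj₁; proj₂; map)
open import Data.Sum using (_⊎_; inj₁; inj₂)
open import Function using (_∘_)
open import Relation.Binary.PropositionalEquality
open import Relation.Nullary using (¬_)
open import Relation.Nullary.Decidable using (False; toWitnessFalse; _×-dec_)

open import Defs

+-cancelˡ-≡′ : ∀ {i i' u u'} → i ≡ i' → i + u ≡ i' + u' → u ≡ u'
+-cancelˡ-≡′ {i} refl = +-cancelˡ-≡ i _ _

+-cancelʳ-≡′ : ∀ {i i' u u'} → u ≡ u' → i + u ≡ i' + u' → i ≡ i'
+-cancelʳ-≡′ {u = u} refl = +-cancelʳ-≡ u _ _

+-cross : ∀ i i' u u' v v' → i + u ≡ i' + u' → i + v ≡ i' + v' → u + v' ≡ u' + v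
+-cross i i' u u' v v' p q = +-cancelˡ-≡ (i + i') _ _ (begin
  (i + i') + (u + v')  ≡⟨ interchange i i' u v' ⟩
  (i + u) + (i' + v')  ≡⟨ cong₂ _+_ p (sym q) ⟩
  (i' + u') + (i + v)  ≡⟨ interchange i' u' i v ⟩
  (i' + i) + (u' + v)  ≡⟨ cong (_+ (u' + v)) (+-comm i' i) ⟩
  (i + i') + (u' + v)  ∎)
  where open ≡-Reasoning

divMod-unique : ∀ {m b b' d d'} .{{_ : NonZero m}} → m ∣ b → m ∣ b' → d < m → d' < m →
                b + d ≡ b' + d' → b ≡ b' × d ≡ d'
divMod-unique {m} {d = d} {d'} (divides q refl) (divides q' refl) d<m d'<m eq =
  +-cancelʳ-≡ d (q * m) (q' * m) (trans eq (cong (q' * m +_) (sym d≡d'))) , d≡d'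
  where
  open ≡-Reasoning
  d≡d' : d ≡ d'
  d≡d' = begin
    d                  ≡⟨ m<n⇒m%n≡m d<m ⟨
    d % m              ≡⟨ [m+kn]%n≡m%n d q m ⟨
    (d + q * m) % m    ≡⟨ cong (_% m) (trans (+-comm d (q * m)) (trans eq (+-comm (q' * m) d'))) ⟩
    (d' + q' * m) % m  ≡⟨ [m+kn]%n≡m%n d' q' m ⟩
    d' % m             ≡⟨ m<n⇒m%n≡m d'<m ⟩
    d'                 ∎

double+bit-injective : ∀ {b b' d d'} → d < 2 → d' < 2 → 2 * b + d ≡ 2 * b' + d' → b ≡ b'
double+bit-injective {b} {b'} d<2 d'<2 eq =
  *-cancelˡ-≡ b b' 2 (proj₁ (divMod-unique (m∣m*n b) (m∣m*n b') d<2 d'<2 eq))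

bits≡2+⇒ : ∀ {d d' s} → d < 2 → d' < 2 → d + d' ≡ 2 + s → d ≡ 1 × d' ≡ 1 × s ≡ 0
bits≡2+⇒ (s≤s (s≤s z≤n)) (s≤s (s≤s z≤n)) refl = refl , refl , refl
bits≡2+⇒ (s≤s z≤n) (s≤s (s≤s z≤n)) ()
bits≡2+⇒ (s≤s (s≤s z≤n)) (s≤s z≤n) ()
bits≡2+⇒ (s≤s z≤n) (s≤s z≤n) ()

bit<10 : ∀ {d} → d < 2 → d < 10
bit<10 d<2 = <-≤-trans d<2 (m≤m+n 2 8)

bits<10 : ∀ c {d d'} → c ≤ 2 → d < 2 → d' < 2 → c + (d + d') < 10
bits<10 c c≤2 d<2 d'<2 = <-≤-trans (+-mono-≤-< c≤2 (+-mono-< d<2 d'<2)) (m≤m+n 6 4)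

Near : ℕ → ℕ → Set
Near c p = p ≡ c ⊎ p ≡ suc c

Offset : ℕ → ℕ → Set
Offset c p = Σ ℕ λ d → d < 2 × p ≡ c + d

offset : ∀ {c p} → Near c p → Offset c p
offset {c} (inj₁ refl) = 0 , s≤s z≤n , sym (+-identityʳ c)
offset {c} (inj₂ refl) = 1 , s≤s (s≤s z≤n) , sym (+-comm c 1)

near-pair-min : ∀ {c p q} → Near c p → Near c q → p ≢ q → p ⊓ q ≡ c
near-pair-min (inj₁ refl) (inj₁ refl) p≢q = ⊥-elim (p≢q refl)
near-pair-min {c} (inj₁ refl) (inj₂ refl) _ = m≤n⇒m⊓n≡m (n≤1+n c)
near-pair-min {c} (inj₂ refl) (inj₁ refl) _ = m≥n⇒m⊓n≡n (n≤1+n c)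
near-pair-min (inj₂ refl) (inj₂ refl) p≢q = ⊥-elim (p≢q refl)

Consecutive : ℕ → ℕ → Set
Consecutive p q = q ≡ suc p ⊎ p ≡ suc q

near-pair-consecutive : ∀ {c p q} → Near c p → Near c q → p ≢ q → Consecutive p q
near-pair-consecutive (inj₁ refl) (inj₁ refl) p≢q = ⊥-elim (p≢q refl)
near-pair-consecutive (inj₁ refl) (inj₂ refl) _ = inj₁ refl
near-pair-consecutive (inj₂ refl) (inj₁ refl) _ = inj₂ refl
near-pair-consecutive (inj₂ refl) (inj₂ refl) p≢q = ⊥-elim (p≢q refl)

consecutive-triangle-free : ∀ {p q r} → Consecutive p q → Consecutive q r → Consecutive p r → ⊥
consecutive-triangle-free (inj₁ refl) (inj₁ refl) (inj₁ ())
consecutive-triangle-free (inj₁ refl) (inj₁ refl) (inj₂ ())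
consecutive-triangle-free (inj₁ refl) (inj₂ refl) (inj₁ ())
consecutive-triangle-free (inj₁ refl) (inj₂ refl) (inj₂ ())
consecutive-triangle-free (inj₂ refl) (inj₁ refl) (inj₁ ())
consecutive-triangle-free (inj₂ refl) (inj₁ refl) (inj₂ ())
consecutive-triangle-free (inj₂ refl) (inj₂ refl) (inj₁ ())
consecutive-triangle-free (inj₂ refl) (inj₂ refl) (inj₂ ())

x∈E-index : ∀ {a i b} → x a ∈E[ i , b ] → Near i a
x∈E-index (inj₁ refl) = inj₁ refl
x∈E-index (inj₂ (inj₁ refl)) = inj₂ refl
x∈E-index (inj₂ (inj₂ (inj₁ ())))
x∈E-index (inj₂ (inj₂ (inj₂ (inj₁ ()))))
x∈E-index (inj₂ (inj₂ (inj₂ (inj₂ ()))))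

y∈E-index : ∀ {j i b} → y j ∈E[ i , b ] → j ≡ i + b
y∈E-index (inj₁ ())
y∈E-index (inj₂ (inj₁ ()))
y∈E-index (inj₂ (inj₂ (inj₁ refl))) = refl
y∈E-index (inj₂ (inj₂ (inj₂ (inj₁ ()))))
y∈E-index (inj₂ (inj₂ (inj₂ (inj₂ ()))))

z∈E-index : ∀ {k i b} → z k ∈E[ i , b ] → Near (i + 2 * b) k
z∈E-index (inj₁ ())
z∈E-index (inj₂ (inj₁ ()))
z∈E-index (inj₂ (inj₂ (inj₁ ())))
z∈E-index (inj₂ (inj₂ (inj₂ (inj₁ refl)))) = inj₁ refl
z∈E-index {i = i} {b} (inj₂ (inj₂ (inj₂ (inj₂ refl)))) = inj₂ (+-comm (i + 2 * b) 1)

yz-distance : ∀ {j k i b} → y j ∈E[ i , b ] → z k ∈E[ i , b ] → Σ ℕ λ e → e < 2 × k ≡ j + (b + e)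
yz-distance {i = i} {b} pj pk with y∈E-index pj | offset (z∈E-index pk)
... | refl | e , e<2 , refl = e , e<2 , regroup i b e
  where
  regroup : ∀ i b e → i + 2 * b + e ≡ i + b + (b + e)
  regroup = solve-∀

-- k − a is b₁ + b₂ via y_j, and 2b₃ directly, up to offsets in {0, 1}.
xyz-slopes-AP : ∀ {a j k i₁ b₁ i₂ b₂ i₃ b₃} → 10 ∣ b₁ → 10 ∣ b₂ → 10 ∣ b₃ →
  x a ∈E[ i₁ , b₁ ] → y j ∈E[ i₁ , b₁ ] → y j ∈E[ i₂ , b₂ ] → z k ∈E[ i₂ , b₂ ] →
  x a ∈E[ i₃ , b₃ ] → z k ∈E[ i₃ , b₃ ] → b₁ + b₂ ≡ 2 * b₃
xyz-slopes-AP {i₁ = i₁} {b₁} {i₂} {b₂} {i₃} {b₃} 10∣b₁ 10∣b₂ 10∣b₃ pa₁ pj₁ pj₂ pk₂ pa₃ pk₃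
  with offset (x∈E-index pa₁) | y∈E-index pj₁ | offset (z∈E-index pk₂)
... | d₁ , d₁<2 , refl | refl | d₂ , d₂<2 , refl
  with y∈E-index pj₂ | offset (x∈E-index pa₃) | offset (z∈E-index pk₃)
... | yy | d₃ , d₃<2 , xx | d₄ , d₄<2 , zz =
  proj₁ (divMod-unique (∣m∣n⇒∣m+n 10∣b₁ 10∣b₂) (∣n⇒∣m*n 2 10∣b₃)
                       (bits<10 0 z≤n d₂<2 d₃<2) (bits<10 0 z≤n d₄<2 d₁<2) slopes)
  where
  open ≡-Reasoning
  s : ℕ
  s = i₁ + i₂ + i₃ + b₂
  slopes : (b₁ + b₂) + (d₂ + d₃) ≡ 2 * b₃ + (d₄ + d₁)
  slopes = +-cancelˡ-≡ s _ _ (begin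
    s + ((b₁ + b₂) + (d₂ + d₃))                      ≡⟨ regroup₁ i₁ i₂ i₃ b₁ b₂ d₂ d₃ ⟩
    (i₁ + b₁) + (i₂ + 2 * b₂ + d₂) + (i₃ + d₃)      ≡⟨ cong₂ _+_ (cong₂ _+_ yy zz) (sym xx) ⟩
    (i₂ + b₂) + (i₃ + 2 * b₃ + d₄) + (i₁ + d₁)      ≡⟨ regroup₂ i₁ i₂ i₃ b₂ b₃ d₁ d₄ ⟩
    s + (2 * b₃ + (d₄ + d₁))                         ∎)
    where
    regroup₁ : ∀ i₁ i₂ i₃ b₁ b₂ d₂ d₃ → i₁ + i₂ + i₃ + b₂ + ((b₁ + b₂) + (d₂ + d₃))
                                       ≡ (i₁ + b₁) + (i₂ + 2 * b₂ + d₂) + (i₃ + d₃)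
    regroup₁ = solve-∀
    regroup₂ : ∀ i₁ i₂ i₃ b₂ b₃ d₁ d₄ → (i₂ + b₂) + (i₃ + 2 * b₃ + d₄) + (i₁ + d₁)
                                       ≡ i₁ + i₂ + i₃ + b₂ + (2 * b₃ + (d₄ + d₁))
    regroup₂ = solve-∀

-- The z-index minus the x-index is 2b + e₁ − d₁ in the first edge and 2b' + e₂ − d₂ + 2 in the
-- second; as 10 divides both slopes, the offsets must be e₁ = d₂ = 1 and e₂ = d₁ = 0.
crossing-starts : ∀ {a k i b i' b'} → 10 ∣ b → 10 ∣ b' →
  x a ∈E[ i , b ] → z (suc k) ∈E[ i , b ] → x (suc a) ∈E[ i' , b' ] → z k ∈E[ i' , b' ] →
  a ≡ i × k ≡ i + 2 * b
crossing-starts {i = i} {b} {i'} {b'} 10∣b 10∣b' pa pk pa' pk'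
  with offset (x∈E-index pa) | offset (z∈E-index pk) | offset (x∈E-index pa') | offset (z∈E-index pk')
... | d₁ , d₁<2 , refl | e₁ , e₁<2 , k+1≡ | d₂ , d₂<2 , a+1≡ | e₂ , e₂<2 , refl =
  trans (cong (i +_) d₁≡0) (+-identityʳ i) ,
  suc-injective (trans k+1≡ (trans (cong (i + 2 * b +_) e₁≡1) (+-comm (i + 2 * b) 1)))
  where
  open ≡-Reasoning
  crossing : 2 * b + (e₁ + d₂) ≡ 2 * b' + (2 + (e₂ + d₁))
  crossing = +-cancelˡ-≡ (i + i') _ _ (begin
    (i + i') + (2 * b + (e₁ + d₂))        ≡⟨ regroup₁ i i' (2 * b) e₁ d₂ ⟩
    (i + 2 * b + e₁) + (i' + d₂)          ≡⟨ cong₂ _+_ k+1≡ a+1≡ ⟨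
    suc (i' + 2 * b' + e₂) + suc (i + d₁)  ≡⟨ regroup₂ i i' (2 * b') e₂ d₁ ⟩
    (i + i') + (2 * b' + (2 + (e₂ + d₁)))  ∎)
    where
    regroup₁ : ∀ i i' c e₁ d₂ → (i + i') + (c + (e₁ + d₂)) ≡ (i + c + e₁) + (i' + d₂)
    regroup₁ = solve-∀
    regroup₂ : ∀ i i' c e₂ d₁ → suc (i' + c + e₂) + suc (i + d₁) ≡ (i + i') + (c + (2 + (e₂ + d₁)))
    regroup₂ = solve-∀
  saturated : e₁ ≡ 1 × d₂ ≡ 1 × e₂ + d₁ ≡ 0
  saturated = bits≡2+⇒ e₁<2 d₂<2 (proj₂ (divMod-unique (∣n⇒∣m*n 2 10∣b) (∣n⇒∣m*n 2 10∣b')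
                                   (bits<10 0 z≤n e₁<2 d₂<2) (bits<10 2 ≤-refl e₂<2 d₁<2) crossing))
  e₁≡1 : e₁ ≡ 1
  e₁≡1 = proj₁ saturated
  d₁≡0 : d₁ ≡ 0
  d₁≡0 = m+n≡0⇒n≡0 e₂ (proj₂ (proj₂ saturated))

Edge : Set
Edge = ℕ × ℕ

_∈ₑ_ : Vtx → Edge → Set
v ∈ₑ e = v ∈E[ proj₁ e , proj₂ e ]

_≼_ : Vtx → Vtx → Set
x a ≼ x a' = Near a a'
z k ≼ z k' = Near k k'
_ ≼ _ = ⊥

y-edge-from-slope : ∀ {j i b i' b'} → y j ∈E[ i , b ] → y j ∈E[ i' , b' ] → b ≡ b' → (i , b) ≡ (i' , b')
y-edge-from-slope pj pj' b≡b' =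
  cong₂ _,_ (+-cancelʳ-≡′ b≡b' (trans (sym (y∈E-index pj)) (y∈E-index pj'))) b≡b'

y-near-slope : ∀ {j v v' i b i' b'} → 10 ∣ b → 10 ∣ b' → v ≼ v' →
  y j ∈E[ i , b ] → v ∈E[ i , b ] → y j ∈E[ i' , b' ] → v' ∈E[ i' , b' ] → b ≡ b'
y-near-slope {v = x a} {x _} {i} {b} {i'} {b'} 10∣b 10∣b' a≼a' pj pa pj' pa'
  with offset a≼a' | offset (x∈E-index pa) | offset (x∈E-index pa')
... | t , t<2 , refl | d , d<2 , a≡ | d' , d'<2 , a+t≡ =
  proj₁ (divMod-unique 10∣b 10∣b' (bit<10 d'<2) (bits<10 0 z≤n d<2 t<2)
    (+-cross i i' b b' (d + t) d' (trans (sym (y∈E-index pj)) (y∈E-index pj')) shifted))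
  where
  open ≡-Reasoning
  shifted : i + (d + t) ≡ i' + d'
  shifted = begin
    i + (d + t)  ≡⟨ +-assoc i d t ⟨
    i + d + t    ≡⟨ cong (_+ t) a≡ ⟨
    a + t        ≡⟨ a+t≡ ⟩
    i' + d'      ∎
y-near-slope {j} {z k} {z _} {b = b} {b' = b'} 10∣b 10∣b' k≼k' pj pk pj' pk'
  with offset k≼k' | yz-distance pj pk | yz-distance pj' pk'
... | t , t<2 , refl | e , e<2 , k≡ | e' , e'<2 , k+t≡ =
  proj₁ (divMod-unique 10∣b 10∣b' (bits<10 0 z≤n e<2 t<2) (bit<10 e'<2) (+-cancelˡ-≡ j _ _ shifted))
  where
  open ≡-Reasoning
  regroup : ∀ j b e t → j + (b + (e + t)) ≡ j + (b + e) + t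
  regroup = solve-∀
  shifted : j + (b + (e + t)) ≡ j + (b' + e')
  shifted = begin
    j + (b + (e + t))  ≡⟨ regroup j b e t ⟩
    j + (b + e) + t    ≡⟨ cong (_+ t) k≡ ⟨
    k + t              ≡⟨ k+t≡ ⟩
    j + (b' + e')      ∎

y-near-determines : ∀ {j v v' e e'} → 10 ∣ proj₂ e → 10 ∣ proj₂ e' → v ≼ v' →
  y j ∈ₑ e → v ∈ₑ e → y j ∈ₑ e' → v' ∈ₑ e' → e ≡ e'
y-near-determines 10∣b 10∣b' v≼v' pj pv pj' pv' =
  y-edge-from-slope pj pj' (y-near-slope 10∣b 10∣b' v≼v' pj pv pj' pv')

xxz-determines : ∀ {a a' k e e'} → a ≢ a' →
  x a ∈ₑ e → x a' ∈ₑ e → z k ∈ₑ e → x a ∈ₑ e' → x a' ∈ₑ e' → z k ∈ₑ e' → e ≡ e'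
xxz-determines {k = k} {i , b} {i' , b'} a≢a' pa pa' pk qa qa' qk
  with offset (z∈E-index pk) | offset (z∈E-index qk)
... | d , d<2 , k≡ | d' , d'<2 , k≡' =
  cong₂ _,_ i≡i' (double+bit-injective d<2 d'<2 (+-cancelˡ-≡′ i≡i' (begin
    i + (2 * b + d)     ≡⟨ +-assoc i (2 * b) d ⟨
    i + 2 * b + d       ≡⟨ k≡ ⟨
    k                   ≡⟨ k≡' ⟩
    i' + 2 * b' + d'    ≡⟨ +-assoc i' (2 * b') d' ⟩
    i' + (2 * b' + d')  ∎)))
  where
  open ≡-Reasoning
  i≡i' : i ≡ i'
  i≡i' = trans (sym (near-pair-min (x∈E-index pa) (x∈E-index pa') a≢a'))
               (near-pair-min (x∈E-index qa) (x∈E-index qa') a≢a')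

xzz-determines : ∀ {a k k' e e'} → k ≢ k' →
  x a ∈ₑ e → z k ∈ₑ e → z k' ∈ₑ e → x a ∈ₑ e' → z k ∈ₑ e' → z k' ∈ₑ e' → e ≡ e'
xzz-determines {e = i , b} {i' , b'} k≢k' pa pk pk' qa qk qk'
  with offset (x∈E-index pa) | offset (x∈E-index qa)
... | d , d<2 , a≡ | d' , d'<2 , a≡' = cong₂ _,_ (+-cancelʳ-≡′ (cong (2 *_) b≡b') start) b≡b'
  where
  start : i + 2 * b ≡ i' + 2 * b'
  start = trans (sym (near-pair-min (z∈E-index pk) (z∈E-index pk') k≢k'))
                (near-pair-min (z∈E-index qk) (z∈E-index qk') k≢k')
  b≡b' : b ≡ b'
  b≡b' = double+bit-injective d'<2 d<2 (+-cross i i' (2 * b) (2 * b') d d' start (trans (sym a≡) a≡'))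

dilate10-∣ : ∀ {B' b} → Dilate10 B' b → 10 ∣ b
dilate10-∣ (β , _ , b≡10β) = divides β (trans b≡10β (*-comm 10 β))

dilate-3AP-free : ∀ {B'} → ThreeAPFree B' → ThreeAPFree (Dilate10 B')
dilate-3AP-free ap _ _ _ (β₁ , B₁ , refl) (β₂ , B₂ , refl) (β₃ , B₃ , refl) eq =
  map (cong (10 *_)) (cong (10 *_)) (ap β₁ β₂ β₃ B₁ B₂ B₃ (*-cancelˡ-≡ _ _ 10 (begin
    10 * (2 * β₁)      ≡⟨ *-assoc 10 2 β₁ ⟨
    2 * 10 * β₁        ≡⟨ *-assoc 2 10 β₁ ⟩
    2 * (10 * β₁)      ≡⟨ eq ⟩
    10 * β₂ + 10 * β₃  ≡⟨ *-distribˡ-+ 10 β₂ β₃ ⟨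
    10 * (β₂ + β₃)     ∎)))
  where open ≡-Reasoning

module DilatedHypergraph {B' : ℕ → Set} (ap : ThreeAPFree B') (n : ℕ) where

  IsEdgeₑ : Edge → Set
  IsEdgeₑ e = IsEdge (Dilate10 B') n (proj₁ e) (proj₂ e)

  _~_ : Vtx → Vtx → Set
  _~_ = Adj (Dilate10 B') n

  Covered : List Vtx → Set
  Covered vs = Σ Edge λ e → IsEdgeₑ e × All (_∈ₑ e) vs

  Determines : List Vtx → Set
  Determines vs = ∀ {e e'} → IsEdgeₑ e → IsEdgeₑ e' → All (_∈ₑ e) vs → All (_∈ₑ e') vs → e ≡ e'

  ~-sym : ∀ {u v} → u ~ v → v ~ u
  ~-sym (u≢v , i , b , E , pu , pv) = u≢v ∘ sym , i , b , E , pv , pu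

  covered-resp-↭ : ∀ {vs ws} → vs ↭ ws → Covered vs → Covered ws
  covered-resp-↭ vs↭ws (e , E , ps) = e , E , All-resp-↭ vs↭ws ps

  glue : ∀ ds {v w} → Determines ds → Covered (ds ++ v ∷ []) → Covered (ds ++ w ∷ []) →
         Covered (ds ++ v ∷ w ∷ [])
  glue ds det (e , E , ps) (e' , E' , ps') with ++⁻ ds ps | ++⁻ ds ps'
  ... | pds , pv ∷ [] | pds' , pw ∷ [] =
    e , E , ++⁺ pds (pv ∷ subst (_ ∈ₑ_) (sym (det E E' pds pds')) pw ∷ [])

  y≁y : ∀ {j j'} → ¬ (y j ~ y j')
  y≁y (yj≢yj' , _ , _ , _ , pj , pj') = yj≢yj' (cong y (trans (y∈E-index pj) (sym (y∈E-index pj'))))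

  x~x⇒consecutive : ∀ {a a'} → x a ~ x a' → Consecutive a a'
  x~x⇒consecutive (xa≢xa' , _ , _ , _ , pa , pa') =
    near-pair-consecutive (x∈E-index pa) (x∈E-index pa') (xa≢xa' ∘ cong x)

  z~z⇒consecutive : ∀ {k k'} → z k ~ z k' → Consecutive k k'
  z~z⇒consecutive (zk≢zk' , _ , _ , _ , pk , pk') =
    near-pair-consecutive (z∈E-index pk) (z∈E-index pk') (zk≢zk' ∘ cong z)

  x-triangle-free : ∀ {a a' a''} → x a ~ x a' → x a' ~ x a'' → x a ~ x a'' → ⊥
  x-triangle-free p q r =
    consecutive-triangle-free (x~x⇒consecutive p) (x~x⇒consecutive q) (x~x⇒consecutive r)

  z-triangle-free : ∀ {k k' k''} → z k ~ z k' → z k' ~ z k'' → z k ~ z k'' → ⊥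
  z-triangle-free p q r =
    consecutive-triangle-free (z~z⇒consecutive p) (z~z⇒consecutive q) (z~z⇒consecutive r)

  y-edge-determines : ∀ {j v} → y j ~ v → Determines (y j ∷ v ∷ [])
  y-edge-determines {v = x _} _ E E' (pj ∷ pa ∷ []) (pj' ∷ pa' ∷ []) =
    y-near-determines (dilate10-∣ (proj₁ E)) (dilate10-∣ (proj₁ E')) (inj₁ refl) pj pa pj' pa'
  y-edge-determines {v = y _} yy = ⊥-elim (y≁y yy)
  y-edge-determines {v = z _} _ E E' (pj ∷ pk ∷ []) (pj' ∷ pk' ∷ []) =
    y-near-determines (dilate10-∣ (proj₁ E)) (dilate10-∣ (proj₁ E')) (inj₁ refl) pj pk pj' pk'

  triangle-determines : ∀ u v w → u ~ v → v ~ w → u ~ w → Determines (u ∷ v ∷ w ∷ [])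
  triangle-determines (y _) _ _ uv _ _ E E' (pu ∷ pv ∷ _ ∷ []) (pu' ∷ pv' ∷ _ ∷ []) =
    y-edge-determines uv E E' (pu ∷ pv ∷ []) (pu' ∷ pv' ∷ [])
  triangle-determines _ (y _) _ uv _ _ E E' (pu ∷ pv ∷ _ ∷ []) (pu' ∷ pv' ∷ _ ∷ []) =
    y-edge-determines (~-sym uv) E E' (pv ∷ pu ∷ []) (pv' ∷ pu' ∷ [])
  triangle-determines _ _ (y _) _ _ uw E E' (pu ∷ _ ∷ pw ∷ []) (pu' ∷ _ ∷ pw' ∷ []) =
    y-edge-determines (~-sym uw) E E' (pw ∷ pu ∷ []) (pw' ∷ pu' ∷ [])
  triangle-determines (x _) (x _) (x _) uv vw uw = ⊥-elim (x-triangle-free uv vw uw)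
  triangle-determines (z _) (z _) (z _) uv vw uw = ⊥-elim (z-triangle-free uv vw uw)
  triangle-determines (x _) (x _) (z _) uv _ _ _ _ (pu ∷ pv ∷ pw ∷ []) (pu' ∷ pv' ∷ pw' ∷ []) =
    xxz-determines (proj₁ uv ∘ cong x) pu pv pw pu' pv' pw'
  triangle-determines (x _) (z _) (x _) _ _ uw _ _ (pu ∷ pv ∷ pw ∷ []) (pu' ∷ pv' ∷ pw' ∷ []) =
    xxz-determines (proj₁ uw ∘ cong x) pu pw pv pu' pw' pv'
  triangle-determines (z _) (x _) (x _) _ vw _ _ _ (pu ∷ pv ∷ pw ∷ []) (pu' ∷ pv' ∷ pw' ∷ []) =
    xxz-determines (proj₁ vw ∘ cong x) pv pw pu pv' pw' pu'
  triangle-determines (x _) (z _) (z _) _ vw _ _ _ (pu ∷ pv ∷ pw ∷ []) (pu' ∷ pv' ∷ pw' ∷ []) =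
    xzz-determines (proj₁ vw ∘ cong z) pu pv pw pu' pv' pw'
  triangle-determines (z _) (x _) (z _) _ _ uw _ _ (pu ∷ pv ∷ pw ∷ []) (pu' ∷ pv' ∷ pw' ∷ []) =
    xzz-determines (proj₁ uw ∘ cong z) pv pu pw pv' pu' pw'
  triangle-determines (z _) (z _) (x _) uv _ _ _ _ (pu ∷ pv ∷ pw ∷ []) (pu' ∷ pv' ∷ pw' ∷ []) =
    xzz-determines (proj₁ uv ∘ cong z) pw pu pv pw' pu' pv'

  xyz-covered : ∀ {a j k} → y j ~ x a → y j ~ z k → x a ~ z k → Covered (y j ∷ x a ∷ z k ∷ [])
  xyz-covered (_ , i₁ , b₁ , E₁ , pj₁ , pa₁) (_ , i₂ , b₂ , E₂ , pj₂ , pk₂) (_ , i₃ , b₃ , E₃ , pa₃ , pk₃) =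
    (i₁ , b₁) , E₁ , pj₁ ∷ pa₁ ∷ subst (_ ∈ₑ_) (sym (y-edge-from-slope pj₁ pj₂ b₁≡b₂)) pk₂ ∷ []
    where
    b₁≡b₂ : b₁ ≡ b₂
    b₁≡b₂ = proj₂ (dilate-3AP-free ap b₃ b₁ b₂ (proj₁ E₃) (proj₁ E₁) (proj₁ E₂)
                    (sym (xyz-slopes-AP (dilate10-∣ (proj₁ E₁)) (dilate10-∣ (proj₁ E₂)) (dilate10-∣ (proj₁ E₃)) pa₁ pj₁ pj₂ pk₂ pa₃ pk₃)))

  y-near-covered : ∀ {j u v} → u ≼ v → y j ~ u → y j ~ v → Covered (y j ∷ u ∷ v ∷ [])
  y-near-covered u≼v (_ , i , b , E , pj , pu) (_ , _ , _ , E' , pj' , pv) =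
    (i , b) , E , pj ∷ pu ∷ subst (_ ∈ₑ_) (sym (y-near-determines (dilate10-∣ (proj₁ E)) (dilate10-∣ (proj₁ E')) u≼v pj pu pj' pv)) pv ∷ []

  y-triangle-covered : ∀ {j} u v → y j ~ u → y j ~ v → u ~ v → Covered (y j ∷ u ∷ v ∷ [])
  y-triangle-covered (y _) _ yu _ _ = ⊥-elim (y≁y yu)
  y-triangle-covered _ (y _) _ yv _ = ⊥-elim (y≁y yv)
  y-triangle-covered (x _) (z _) yu yv uv = xyz-covered yu yv uv
  y-triangle-covered (z _) (x _) yu yv uv =
    covered-resp-↭ (↭-prep _ (↭-swap _ _ ↭-refl)) (xyz-covered yv yu (~-sym uv))
  y-triangle-covered (x _) (x _) yu yv uv with x~x⇒consecutive uv
  ... | inj₁ refl = y-near-covered (inj₂ refl) yu yv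
  ... | inj₂ refl = covered-resp-↭ (↭-prep _ (↭-swap _ _ ↭-refl)) (y-near-covered (inj₂ refl) yv yu)
  y-triangle-covered (z _) (z _) yu yv uv with z~z⇒consecutive uv
  ... | inj₁ refl = y-near-covered (inj₂ refl) yu yv
  ... | inj₂ refl = covered-resp-↭ (↭-prep _ (↭-swap _ _ ↭-refl)) (y-near-covered (inj₂ refl) yv yu)

  y-fan-covered : ∀ {j} u v w → y j ~ u → y j ~ v → y j ~ w → u ~ v → u ~ w →
                  Covered (y j ∷ u ∷ v ∷ w ∷ [])
  y-fan-covered u v w yu yv yw uv uw =
    glue (_ ∷ u ∷ []) (y-edge-determines yu) (y-triangle-covered u v yu yv uv) (y-triangle-covered u w yu yw uw)

  xxzz-core : ∀ {a k} → x a ~ z (suc k) → x (suc a) ~ z k → Covered (x a ∷ x (suc a) ∷ z k ∷ z (suc k) ∷ [])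
  xxzz-core (_ , i , b , E , pa , pk) (_ , _ , _ , E' , pa' , pk')
    with crossing-starts (dilate10-∣ (proj₁ E)) (dilate10-∣ (proj₁ E')) pa pk pa' pk'
  ... | refl , refl = (i , b) , E , pa ∷ inj₂ (inj₁ refl) ∷ inj₂ (inj₂ (inj₂ (inj₁ refl))) ∷ pk ∷ []

  xxzz-covered : ∀ {a a' k k'} → x a ~ x a' → z k ~ z k' →
    x a ~ z k → x a ~ z k' → x a' ~ z k → x a' ~ z k' → Covered (x a ∷ x a' ∷ z k ∷ z k' ∷ [])
  xxzz-covered xx zz xz xz' x'z x'z' with x~x⇒consecutive xx | z~z⇒consecutive zz
  ... | inj₁ refl | inj₁ refl = xxzz-core xz' x'z
  ... | inj₁ refl | inj₂ refl = covered-resp-↭ (↭-prep _ (↭-prep _ (↭-swap _ _ ↭-refl))) (xxzz-core xz x'z')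
  ... | inj₂ refl | inj₁ refl = covered-resp-↭ (↭-swap _ _ ↭-refl) (xxzz-core x'z' xz)
  ... | inj₂ refl | inj₂ refl = covered-resp-↭ (↭-swap _ _ (↭-swap _ _ ↭-refl)) (xxzz-core x'z xz')

  k4-covered : ∀ a b c d → a ~ b → a ~ c → a ~ d → b ~ c → b ~ d → c ~ d → Covered (a ∷ b ∷ c ∷ d ∷ [])
  k4-covered (y _) b c d ab ac ad bc bd _ = y-fan-covered b c d ab ac ad bc bd
  k4-covered a (y _) c d ab ac ad bc bd _ =
    covered-resp-↭ (↭-sym (shift _ (a ∷ []) (c ∷ d ∷ []))) (y-fan-covered a c d (~-sym ab) bc bd ac ad)
  k4-covered a b (y _) d ab ac ad bc _ cd =
    covered-resp-↭ (↭-sym (shift _ (a ∷ b ∷ []) (d ∷ []))) (y-fan-covered a b d (~-sym ac) (~-sym bc) cd ab ad)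
  k4-covered a b c (y _) ab ac ad _ bd cd =
    covered-resp-↭ (↭-sym (shift _ (a ∷ b ∷ c ∷ []) [])) (y-fan-covered a b c (~-sym ad) (~-sym bd) (~-sym cd) ab ac)
  k4-covered (x _) (x _) (x _) _ ab ac _ bc _ _ = ⊥-elim (x-triangle-free ab bc ac)
  k4-covered (x _) (x _) _ (x _) ab _ ad _ bd _ = ⊥-elim (x-triangle-free ab bd ad)
  k4-covered (x _) _ (x _) (x _) _ ac ad _ _ cd = ⊥-elim (x-triangle-free ac cd ad)
  k4-covered _ (x _) (x _) (x _) _ _ _ bc bd cd = ⊥-elim (x-triangle-free bc cd bd)
  k4-covered (z _) (z _) (z _) _ ab ac _ bc _ _ = ⊥-elim (z-triangle-free ab bc ac)
  k4-covered (z _) (z _) _ (z _) ab _ ad _ bd _ = ⊥-elim (z-triangle-free ab bd ad)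
  k4-covered (z _) _ (z _) (z _) _ ac ad _ _ cd = ⊥-elim (z-triangle-free ac cd ad)
  k4-covered _ (z _) (z _) (z _) _ _ _ bc bd cd = ⊥-elim (z-triangle-free bc cd bd)
  k4-covered (x _) (x _) (z _) (z _) ab ac ad bc bd cd = xxzz-covered ab cd ac ad bc bd
  k4-covered (x _) (z _) (x _) (z _) ab ac ad bc bd cd =
    covered-resp-↭ (↭-prep _ (↭-swap _ _ ↭-refl)) (xxzz-covered ac bd ab ad (~-sym bc) cd)
  k4-covered (x _) (z _) (z _) (x _) ab ac ad bc bd cd =
    covered-resp-↭ (↭-prep _ (↭-sym (shift _ (_ ∷ _ ∷ []) []))) (xxzz-covered ad bc ab ac (~-sym bd) (~-sym cd))
  k4-covered (z _) (x _) (x _) (z _) ab ac ad bc bd cd =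
    covered-resp-↭ (shift _ (_ ∷ _ ∷ []) (_ ∷ [])) (xxzz-covered bc ad (~-sym ab) bd (~-sym ac) cd)
  k4-covered (z _) (x _) (z _) (x _) ab ac ad bc bd cd =
    covered-resp-↭ (↭-trans (shift _ (_ ∷ _ ∷ []) (_ ∷ [])) (↭-prep _ (↭-prep _ (↭-swap _ _ ↭-refl))))
      (xxzz-covered bd ac (~-sym ab) bc (~-sym ad) (~-sym cd))
  k4-covered (z _) (z _) (x _) (x _) ab ac ad bc bd cd =
    covered-resp-↭ (++-comm (_ ∷ _ ∷ []) (_ ∷ _ ∷ [])) (xxzz-covered cd ab (~-sym ac) (~-sym bc) (~-sym ad) (~-sym bd))

  k5⁻-covered : ∀ {f} → IsK5Minus (Dilate10 B') n f → Covered (tabulate f)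
  k5⁻-covered {f} (_ , adj) =
    covered-resp-↭ (++-comm (f 2F ∷ f 3F ∷ f 4F ∷ []) (f 0F ∷ f 1F ∷ []))
      (glue (f 2F ∷ f 3F ∷ f 4F ∷ []) (triangle-determines _ _ _ (f~ 2F 3F) (f~ 3F 4F) (f~ 2F 4F))
        (k4-covered _ _ _ _ (f~ 2F 3F) (f~ 2F 4F) (f~ 2F 0F) (f~ 3F 4F) (f~ 3F 0F) (f~ 4F 0F))
        (k4-covered _ _ _ _ (f~ 2F 3F) (f~ 2F 4F) (f~ 2F 1F) (f~ 3F 4F) (f~ 3F 1F) (f~ 4F 1F)))
    where
    f~ : ∀ j k {j≢k : False (j ≟ k)} {¬01 : False (j ≟ 0F ×-dec k ≟ 1F)} {¬10 : False (j ≟ 1F ×-dec k ≟ 0F)} →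
         f j ~ f k
    f~ j k {j≢k} {¬01} {¬10} = adj j k (toWitnessFalse j≢k) (toWitnessFalse ¬01) (toWitnessFalse ¬10)

mainTheorem9 : (n : ℕ) (B' : ℕ → Set) → ThreeAPFree B' →
    SubsetRange (Dilate10 B') n → InducedK5MinusFree (Dilate10 B') n
mainTheorem9 n B' ap _ f k5⁻ with DilatedHypergraph.k5⁻-covered ap n k5⁻
... | (i , b) , E , cover = i , b , E , tabulate⁻ cover
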